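{- Let $r$ be an odd positive integer with $r \equiv 0 \pmod 3$, and let $\Sigma = \{a,b\}$. The partial word $w = \diamond^{r-1}\, a\, b\, a\, \diamond^{r-2}\, b\, a\, a\, \diamond^{r-3}$ contains exactly three $r$th powers (as factors), all of which start at position $1$.
   Context: $\diamond$ is a hole symbol; a partial word is a finite sequence over $\Sigma \cup \{\diamond\}$, a full word one with no holes, and $\diamond^m$ denotes $m$ consecutive holes (empty if $m=0$). Positions are indexed from $1$; $w[i..j]$ is the factor occupying positions $i$ to $j$, said to start at position $i$. For partial words $u, v$ of equal length, $u \subset v$ means that every non-hole position of $u$ is a non-hole position of $v$ carrying the same letter. A partial word $u$ is an $r$th power if $u \subset x^r$ for some nonempty full word $x$. -}

module Defs where

open import Data.Nat using (ℕ; zero; suc; _+_; _*_; _∸_)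
open import Data.List using (List; []; _∷_; _++_; map; concat; replicate; take; drop)
open import Data.List.Relation.Binary.Pointwise using (Pointwise)
open import Data.Product using (∃; _×_)
open import Relation.Nullary using (¬_)
open import Relation.Binary.PropositionalEquality using (_≡_)

data Letter : Set where
  a b : Letter

data Sym : Set where
  ◇   : Sym
  ⟨_⟩ : Letter → Sym

PWord : Set
PWord = List Sym

FWord : Set
FWord = List Letter

full : FWord → PWord
full = map ⟨_⟩

holes : ℕ → PWord
holes m = replicate m ◇

data _⊏_ : Sym → Sym → Set where
  hole⊏ : ∀ {s} → ◇ ⊏ s
  lett⊏ : ∀ {c} → ⟨ c ⟩ ⊏ ⟨ c ⟩

_⊂_ : PWord → PWord → Set
u ⊂ v = Pointwise _⊏_ u v

_^ʷ_ : FWord → ℕ → FWord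
x ^ʷ r = concat (replicate r x)

IsPower : ℕ → PWord → Set
IsPower r u = ∃ λ (x : FWord) → ¬ (x ≡ []) × (u ⊂ full (x ^ʷ r))

-- factor w[i..j] (1-indexed, positions i to j inclusive)
factor : PWord → ℕ → ℕ → PWord
factor w i j = take (suc j ∸ i) (drop (i ∸ 1) w)

wordW : ℕ → PWord
wordW r = holes (r ∸ 1) ++ (⟨ a ⟩ ∷ ⟨ b ⟩ ∷ ⟨ a ⟩ ∷ [])
       ++ holes (r ∸ 2) ++ (⟨ b ⟩ ∷ ⟨ a ⟩ ∷ ⟨ a ⟩ ∷ [])
       ++ holes (r ∸ 3)

module Submission where

-- Write r = 3 + t and W t = ◇^{t+2} aba ◇^{t+1} baa ◇^t (so W t = wordW r).
-- Reading positions 0-indexed, W t carries the letters a, b, a at 2+t, 3+t, 4+t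
-- and b, a, a at 6+2t, 7+2t, 8+2t; every other position is a hole.
--
-- If a factor is contained in x^r, its letters are periodic modulo
-- |x|: two letters at distance a multiple of |x| agree (lemma `agree`).  The
-- factor has length r·|x| ≤ |W t| = 3r, so |x| ≤ 3, and |x| = 3 forces the
-- factor to be the whole word.  For |x| ∈ {1, 2} and a factor not starting at
-- the first position, an explicit pair of distinct letters a/b at distance a
-- multiple of |x| lies inside the factor (for |x| = 2 this uses that r is odd).
--
-- The prefixes of lengths r, 2r, 3r are contained in a^r, (ab)^r
-- and (baa)^r respectively; the last one needs 3 ∣ r.

open import Defs
open import Data.Nat using (ℕ; zero; suc; _+_; _*_; _∸_; _≤_; _<_; z≤n; s≤s; NonZero)
open import Data.Nat.Properties
open import Data.Nat.DivMod using (_%_; _/_; m≡m%n+[m/n]*n; m%n<n; [m+kn]%n≡m%n)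
open import Data.Nat.Divisibility using (_∣_; divides)
open import Data.Nat.Tactic.RingSolver using (solve-∀)
open import Data.List using (List; []; _∷_; _++_; length; take; drop)
open import Data.List.Properties using (++-assoc; ++-identityʳ; length-++; length-map; length-take; length-drop; length-replicate; map-++)
open import Data.List.Relation.Binary.Pointwise using ([]; _∷_; ++⁺; Pointwise-length)
open import Data.Maybe using (Maybe; just; nothing)
open import Data.Maybe.Properties using (just-injective)
open import Data.Product using (_×_; _,_; ∃)
open import Data.Sum using (_⊎_; inj₁; inj₂)
open import Data.Empty using (⊥; ⊥-elim)
open import Function.Bundles using (_⇔_; mk⇔)
open import Relation.Nullary using (¬_)
open import Relation.Binary.PropositionalEquality
open ≡-Reasoning

_!_ : {A : Set} → List A → ℕ → Maybe A
[] ! _ = nothing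
(x ∷ xs) ! zero = just x
(x ∷ xs) ! suc k = xs ! k

!-++ˡ : {A : Set} (xs ys : List A) {k : ℕ} → k < length xs → (xs ++ ys) ! k ≡ xs ! k
!-++ˡ (x ∷ xs) ys {zero} _ = refl
!-++ˡ (x ∷ xs) ys {suc k} (s≤s k<n) = !-++ˡ xs ys k<n

!-++ʳ : {A : Set} (xs ys : List A) (k : ℕ) → (xs ++ ys) ! (length xs + k) ≡ ys ! k
!-++ʳ [] ys k = refl
!-++ʳ (x ∷ xs) ys k = !-++ʳ xs ys k

!-take : {A : Set} (n : ℕ) (xs : List A) {k : ℕ} → k < n → take n xs ! k ≡ xs ! k
!-take (suc n) [] _ = refl
!-take (suc n) (x ∷ xs) {zero} _ = refl
!-take (suc n) (x ∷ xs) {suc k} (s≤s k<n) = !-take n xs k<n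

!-drop : {A : Set} (n : ℕ) (xs : List A) (k : ℕ) → drop n xs ! k ≡ xs ! (n + k)
!-drop zero xs k = refl
!-drop (suc n) [] k = refl
!-drop (suc n) (x ∷ xs) k = !-drop n xs k

!-holes : (n : ℕ) (ys : PWord) (k : ℕ) → (holes n ++ ys) ! (k + n) ≡ ys ! k
!-holes zero ys k = cong (ys !_) (+-identityʳ k)
!-holes (suc n) ys k = trans (cong ((holes (suc n) ++ ys) !_) (+-suc k n)) (!-holes n ys k)

!-full : (y : FWord) (k : ℕ) {c : Letter} → full y ! k ≡ just ⟨ c ⟩ → y ! k ≡ just c
!-full [] k ()
!-full (x ∷ y) zero refl = refl
!-full (x ∷ y) (suc k) e = !-full y k e

!-⊂ : {u v : PWord} {k : ℕ} {c : Letter} → u ⊂ v → u ! k ≡ just ⟨ c ⟩ → v ! k ≡ just ⟨ c ⟩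
!-⊂ {k = zero} (hole⊏ ∷ _) ()
!-⊂ {k = zero} (lett⊏ ∷ _) e = e
!-⊂ {k = suc k} (_ ∷ u⊂v) e = !-⊂ u⊂v e

length-full-^ʷ : (x : FWord) (r : ℕ) → length (full (x ^ʷ r)) ≡ r * length x
length-full-^ʷ x r = trans (length-map ⟨_⟩ (x ^ʷ r)) (length-^ʷ r)
  where
  length-^ʷ : ∀ r → length (x ^ʷ r) ≡ r * length x
  length-^ʷ zero = refl
  length-^ʷ (suc r) = trans (length-++ x) (cong (length x +_) (length-^ʷ r))

!-^ʷ : (x : FWord) (r q : ℕ) {ρ : ℕ} {c : Letter} → ρ < length x →
       (x ^ʷ r) ! (ρ + q * length x) ≡ just c → x ! ρ ≡ just c
!-^ʷ x zero q ρ<n ()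
!-^ʷ x (suc r) zero {ρ} ρ<n e =
  trans (sym (!-++ˡ x (x ^ʷ r) ρ<n)) (trans (cong ((x ^ʷ suc r) !_) (sym (+-identityʳ ρ))) e)
!-^ʷ x (suc r) (suc q) {ρ} ρ<n e = !-^ʷ x r q ρ<n (begin
  (x ^ʷ r) ! (ρ + q * length x)                   ≡⟨ !-++ʳ x (x ^ʷ r) (ρ + q * length x) ⟨
  (x ^ʷ suc r) ! (length x + (ρ + q * length x))  ≡⟨ cong ((x ^ʷ suc r) !_) (shift (length x) ρ (q * length x)) ⟩
  (x ^ʷ suc r) ! (ρ + suc q * length x)           ≡⟨ e ⟩
  just _                                          ∎)
  where
  shift : ∀ n ρ m → n + (ρ + m) ≡ ρ + (n + m)
  shift = solve-∀

!-^ʷ-mod : (x : FWord) (r k : ℕ) {c : Letter} .{{_ : NonZero (length x)}} →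
           (x ^ʷ r) ! k ≡ just c → x ! (k % length x) ≡ just c
!-^ʷ-mod x r k e =
  !-^ʷ x r (k / length x) (m%n<n k (length x))
    (trans (cong ((x ^ʷ r) !_) (sym (m≡m%n+[m/n]*n k (length x)))) e)

-- `PowerAt r w i x`: the factor of w of length r·|x| beginning right after
-- position i (counted from 1) is contained in x^r.
record PowerAt (r : ℕ) (w : PWord) (i : ℕ) (x : FWord) : Set where
  constructor power-at
  field contained : factor w (suc i) (i + r * length x) ⊂ full (x ^ʷ r)

!-factor : (w : PWord) (i L k : ℕ) → k < L → factor w (suc i) (i + L) ! k ≡ w ! (i + k)
!-factor w i L k k<L = begin
  take (i + L ∸ i) (drop i w) ! k  ≡⟨ cong (λ n → take n (drop i w) ! k) (m+n∸m≡n i L) ⟩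
  take L (drop i w) ! k            ≡⟨ !-take L (drop i w) k<L ⟩
  drop i w ! k                     ≡⟨ !-drop i w k ⟩
  w ! (i + k)                      ∎

agree : {r : ℕ} {w : PWord} {i : ℕ} (x : FWord) {c c′ : Letter} .{{_ : NonZero (length x)}}
        (P m : ℕ) → PowerAt r w i x → i ≤ P → m * length x + P < i + r * length x →
        w ! P ≡ just ⟨ c ⟩ → w ! (m * length x + P) ≡ just ⟨ c′ ⟩ → c ≡ c′
agree {r} {w} {i} x {c} {c′} P m (power-at power) i≤P Q<end cAtP c′AtQ = just-injective (begin
  just c                 ≡⟨ letter k k<L (subst (λ p → w ! p ≡ just ⟨ c ⟩) (sym P≡) cAtP) ⟨
  x ! (k % n)            ≡⟨ cong (x !_) ([m+kn]%n≡m%n k m n) ⟨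
  x ! ((k + m * n) % n)  ≡⟨ letter (k + m * n) k+mn<L (subst (λ p → w ! p ≡ just ⟨ c′ ⟩) (sym Q≡) c′AtQ) ⟩
  just c′                ∎)
  where
  n = length x
  L = r * n
  k = P ∸ i
  P≡ : i + k ≡ P
  P≡ = m+[n∸m]≡n i≤P
  Q≡ : i + (k + m * n) ≡ m * n + P
  Q≡ = trans (sym (+-assoc i k (m * n))) (trans (cong (_+ m * n) P≡) (+-comm P (m * n)))
  k+mn<L : k + m * n < L
  k+mn<L = +-cancelˡ-< i (k + m * n) L (subst (_< i + L) (sym Q≡) Q<end)
  k<L : k < L
  k<L = ≤-<-trans (m≤m+n k (m * n)) k+mn<L
  letter : ∀ p {d} → p < L → w ! (i + p) ≡ just ⟨ d ⟩ → x ! (p % n) ≡ just d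
  letter p p<L e = !-^ʷ-mod x r p (!-full (x ^ʷ r) p (!-⊂ power (trans (!-factor w i L p p<L) e)))

power-end : (w : PWord) (r i j : ℕ) (x : FWord) → suc i ≤ j → j ≤ length w →
            factor w (suc i) j ⊂ full (x ^ʷ r) → j ≡ i + r * length x
power-end w r i j x i<j j≤|w| contained = begin
  j                                ≡⟨ m+[n∸m]≡n (<⇒≤ i<j) ⟨
  i + (j ∸ i)                      ≡⟨ cong (i +_) length-factor ⟨
  i + length (factor w (suc i) j)  ≡⟨ cong (i +_) (Pointwise-length contained) ⟩
  i + length (full (x ^ʷ r))       ≡⟨ cong (i +_) (length-full-^ʷ x r) ⟩
  i + r * length x                 ∎
  where
  length-factor : length (factor w (suc i) j) ≡ j ∸ i
  length-factor = trans (length-take (j ∸ i) (drop i w))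
    (m≤n⇒m⊓n≡m (subst (j ∸ i ≤_) (sym (length-drop i w)) (∸-monoˡ-≤ i j≤|w|)))

holes⊂ : (n : ℕ) (v : PWord) → length v ≡ n → holes n ⊂ v
holes⊂ zero [] _ = []
holes⊂ (suc n) (_ ∷ v) |v|≡n = hole⊏ ∷ holes⊂ n v (suc-injective |v|≡n)

full-^ʷ-+ : (x : FWord) (m n : ℕ) → full (x ^ʷ (m + n)) ≡ full (x ^ʷ m) ++ full (x ^ʷ n)
full-^ʷ-+ x m n = trans (cong full (^ʷ-+ m)) (map-++ ⟨_⟩ (x ^ʷ m) (x ^ʷ n))
  where
  ^ʷ-+ : ∀ m → x ^ʷ (m + n) ≡ x ^ʷ m ++ x ^ʷ n
  ^ʷ-+ zero = refl
  ^ʷ-+ (suc m) = trans (cong (x ++_) (^ʷ-+ m)) (sym (++-assoc x (x ^ʷ m) (x ^ʷ n)))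

pad : (x : FWord) (m k n : ℕ) {u : PWord} → n ≡ m * length x →
      u ⊂ full (x ^ʷ k) → (holes n ++ u) ⊂ full (x ^ʷ (m + k))
pad x m k n {u} n≡ u⊂ = subst ((holes n ++ u) ⊂_) (sym (full-^ʷ-+ x m k))
  (++⁺ (holes⊂ n (full (x ^ʷ m)) (trans (length-full-^ʷ x m) (sym n≡))) u⊂)

power-exponent : (x : FWord) {u : PWord} {m n : ℕ} → m ≡ n → u ⊂ full (x ^ʷ m) → u ⊂ full (x ^ʷ n)
power-exponent x {u} m≡n = subst (λ e → u ⊂ full (x ^ʷ e)) m≡n

take-length-++ : (U V : PWord) → take (length U) (U ++ V) ≡ U
take-length-++ [] V = refl
take-length-++ (s ∷ U) V = cong (s ∷_) (take-length-++ U V)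

prefix-power : (r : ℕ) (x : FWord) {w : PWord} (U V : PWord) → w ≡ U ++ V → ¬ x ≡ [] →
               U ⊂ full (x ^ʷ r) → IsPower r (factor w 1 (r * length x))
prefix-power r x U V refl x≢[] U⊂ = x , x≢[] , subst (_⊂ full (x ^ʷ r)) (sym prefix) U⊂
  where
  |U| : length U ≡ r * length x
  |U| = trans (Pointwise-length U⊂) (length-full-^ʷ x r)
  prefix : take (r * length x) (U ++ V) ≡ U
  prefix = trans (cong (λ n → take n (U ++ V)) (sym |U|)) (take-length-++ U V)

length-holes++ : (n : ℕ) (ys : PWord) → length (holes n ++ ys) ≡ n + length ys
length-holes++ n ys = trans (length-++ (holes n)) (cong (_+ length ys) (length-replicate n))

holes-suc-++ : (n : ℕ) (ys : PWord) → holes (suc n) ++ ys ≡ holes n ++ (◇ ∷ ys)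
holes-suc-++ zero ys = refl
holes-suc-++ (suc n) ys = cong (◇ ∷_) (holes-suc-++ n ys)

<-by : {m n : ℕ} (d : ℕ) → suc m + d ≡ n → m < n
<-by {m} d refl = m≤m+n (suc m) d

locate : (n k : ℕ) → n ≤ k ⊎ n ≡ 1 + k ⊎ n ≡ 2 + k ⊎ 3 + k ≤ n
locate zero k = inj₁ z≤n
locate (suc zero) zero = inj₂ (inj₁ refl)
locate (suc (suc zero)) zero = inj₂ (inj₂ (inj₁ refl))
locate (suc (suc (suc n))) zero = inj₂ (inj₂ (inj₂ (s≤s (s≤s (s≤s z≤n)))))
locate (suc n) (suc k) with locate n k
... | inj₁ n≤k = inj₁ (s≤s n≤k)
... | inj₂ (inj₁ n≡) = inj₂ (inj₁ (cong suc n≡))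
... | inj₂ (inj₂ (inj₁ n≡)) = inj₂ (inj₂ (inj₁ (cong suc n≡)))
... | inj₂ (inj₂ (inj₂ 3+k≤n)) = inj₂ (inj₂ (inj₂ (s≤s 3+k≤n)))

even-or-odd : (m : ℕ) → (∃ λ q → m ≡ q + q) ⊎ (∃ λ q → m ≡ suc (q + q))
even-or-odd zero = inj₁ (0 , refl)
even-or-odd (suc m) with even-or-odd m
... | inj₁ (q , m≡) = inj₂ (q , cong suc m≡)
... | inj₂ (q , m≡) = inj₁ (suc q , trans (cong suc m≡) (cong suc (sym (+-suc q q))))

odd-multiple-of-three : {r : ℕ} → ¬ (2 ∣ r) → 3 ∣ r → ∃ λ q → r ≡ 3 + (q * 3 + q * 3)
odd-multiple-of-three odd (divides m r≡m*3) with even-or-odd m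
... | inj₁ (q , refl) = ⊥-elim (odd (divides (q * 3) (trans r≡m*3 (even q))))
  where
  even : ∀ q → (q + q) * 3 ≡ q * 3 * 2
  even = solve-∀
... | inj₂ (q , refl) = q , trans r≡m*3 (odd-form q)
  where
  odd-form : ∀ q → suc (q + q) * 3 ≡ 3 + (q * 3 + q * 3)
  odd-form = solve-∀

-- The word of the theorem for r = 3 + t; definitionally
-- W t = holes (2 + t) ++ a ∷ b ∷ a ∷ (holes (1 + t) ++ tailW t).
W : ℕ → PWord
W t = wordW (3 + t)

tailW : ℕ → PWord
tailW t = ⟨ b ⟩ ∷ ⟨ a ⟩ ∷ ⟨ a ⟩ ∷ holes t

first-block : (t k : ℕ) → W t ! (k + (2 + t)) ≡ (⟨ a ⟩ ∷ ⟨ b ⟩ ∷ ⟨ a ⟩ ∷ (holes (1 + t) ++ tailW t)) ! k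
first-block t k = !-holes (2 + t) _ k

second-block : (t k : ℕ) → W t ! (k + (6 + (t + t))) ≡ tailW t ! k
second-block t k = begin
  W t ! (k + (6 + (t + t)))              ≡⟨ cong (W t !_) (position t k) ⟩
  W t ! ((3 + (k + (1 + t))) + (2 + t))  ≡⟨ first-block t (3 + (k + (1 + t))) ⟩
  (holes (1 + t) ++ tailW t) ! (k + (1 + t)) ≡⟨ !-holes (1 + t) (tailW t) k ⟩
  tailW t ! k                            ∎
  where
  position : ∀ t k → k + (6 + (t + t)) ≡ (3 + (k + (1 + t))) + (2 + t)
  position = solve-∀

a₁ : (t : ℕ) → W t ! (2 + t) ≡ just ⟨ a ⟩
a₁ t = first-block t 0

b₁ : (t : ℕ) → W t ! (3 + t) ≡ just ⟨ b ⟩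
b₁ t = first-block t 1

a₂ : (t : ℕ) → W t ! (4 + t) ≡ just ⟨ a ⟩
a₂ t = first-block t 2

b₂ : (t : ℕ) → W t ! (6 + (t + t)) ≡ just ⟨ b ⟩
b₂ t = second-block t 0

b₂-at : (t : ℕ) {p : ℕ} → 6 + (t + t) ≡ p → W t ! p ≡ just ⟨ b ⟩
b₂-at t refl = b₂ t

a₃ : (t : ℕ) → W t ! (7 + (t + t)) ≡ just ⟨ a ⟩
a₃ t = second-block t 1

a≢b : a ≡ b → ⊥
a≢b ()

b≢a : b ≡ a → ⊥
b≢a ()

length-W : (t : ℕ) → length (W t) ≡ 3 * (3 + t)
length-W t = begin
  length (W t)                                                ≡⟨ length-holes++ (2 + t) _ ⟩
  (2 + t) + (3 + length (holes (1 + t) ++ tailW t))           ≡⟨ cong (λ l → (2 + t) + (3 + l)) (length-holes++ (1 + t) (tailW t)) ⟩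
  (2 + t) + (3 + ((1 + t) + (3 + length (holes t))))          ≡⟨ cong (λ l → (2 + t) + (3 + ((1 + t) + (3 + l)))) (length-replicate t) ⟩
  (2 + t) + (3 + ((1 + t) + (3 + t)))                         ≡⟨ total t ⟩
  3 * (3 + t)                                                 ∎
  where
  total : ∀ t → (2 + t) + (3 + ((1 + t) + (3 + t))) ≡ 3 * (3 + t)
  total = solve-∀

-- No r-th power of a single letter begins after the first position: the factor
-- always contains an a and a b (at 2+t/3+t, 3+t/4+t, 4+t/6+2t or 6+2t/7+2t).
no-shifted-letter-power : (t e : ℕ) (c : Letter) → PowerAt (3 + t) (W t) (suc e) (c ∷ []) →
                          suc e + (3 + t) * 1 ≤ 3 * (3 + t) → ⊥
no-shifted-letter-power t e c = by-location (locate e (1 + t))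
  where
  L = (3 + t) * 1

  early : ∀ t e → suc (3 + t) + e ≡ suc e + (3 + t) * 1
  early = solve-∀
  at-b₁ : ∀ t → suc (4 + t) + (1 + t) ≡ (3 + t) + (3 + t) * 1
  at-b₁ = solve-∀
  at-a₂ : ∀ t → suc ((2 + t) * 1 + (4 + t)) + 0 ≡ (4 + t) + (3 + t) * 1
  at-a₂ = solve-∀
  to-b₂ : ∀ t → 6 + (t + t) ≡ (2 + t) * 1 + (4 + t)
  to-b₂ = solve-∀
  late : ∀ t d → suc (7 + (t + t)) + d ≡ 5 + t + d + (3 + t) * 1
  late = solve-∀
  room : ∀ t → 3 * (3 + t) ≡ 6 + (t + t) + (3 + t) * 1
  room = solve-∀

  by-location : ∀ {e} → e ≤ 1 + t ⊎ e ≡ 2 + t ⊎ e ≡ 3 + t ⊎ 4 + t ≤ e →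
                PowerAt (3 + t) (W t) (suc e) (c ∷ []) → suc e + L ≤ 3 * (3 + t) → ⊥
  by-location {e} (inj₁ e≤1+t) power _ =
    a≢b (agree (c ∷ []) (2 + t) 1 power (s≤s e≤1+t) (<-by e (early t e)) (a₁ t) (b₁ t))
  by-location (inj₂ (inj₁ refl)) power _ =
    b≢a (agree (c ∷ []) (3 + t) 1 power ≤-refl (<-by (1 + t) (at-b₁ t)) (b₁ t) (a₂ t))
  by-location (inj₂ (inj₂ (inj₁ refl))) power _ =
    a≢b (agree (c ∷ []) (4 + t) (2 + t) power ≤-refl (<-by 0 (at-a₂ t))
          (a₂ t) (b₂-at t (to-b₂ t)))
  by-location (inj₂ (inj₂ (inj₂ 4+t≤e))) power fits with m≤n⇒∃[o]m+o≡n 4+t≤e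
  ... | d , refl =
    b≢a (agree (c ∷ []) (6 + (t + t)) 1 power start≤b₂ (<-by d (late t d)) (b₂ t) (a₃ t))
    where
    start≤b₂ : 5 + t + d ≤ 6 + (t + t)
    start≤b₂ = +-cancelʳ-≤ L (5 + t + d) (6 + (t + t)) (subst (5 + t + d + L ≤_) (room t) fits)

-- No r-th power of a two-letter word begins after the first position, for odd
-- r = 3 + 2s: the factor contains the a at 2+t or at 4+t together with the b at
-- 6+2t, at distance r + 1 or r - 1, both even.
no-shifted-square-power : (s e : ℕ) (c₁ c₂ : Letter) →
                          PowerAt (3 + (s + s)) (W (s + s)) (suc e) (c₁ ∷ c₂ ∷ []) →
                          suc e + (3 + (s + s)) * 2 ≤ 3 * (3 + (s + s)) → ⊥
no-shifted-square-power s e c₁ c₂ = by-location (locate e (1 + t))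
  where
  t = s + s
  L = (3 + t) * 2

  b₂-from-a₁ : ∀ s → 6 + ((s + s) + (s + s)) ≡ (2 + s) * 2 + (2 + (s + s))
  b₂-from-a₁ = solve-∀
  b₂-from-a₂ : ∀ s → 6 + ((s + s) + (s + s)) ≡ (1 + s) * 2 + (4 + (s + s))
  b₂-from-a₂ = solve-∀
  early : ∀ s e → suc ((2 + s) * 2 + (2 + (s + s))) + e ≡ suc e + (3 + (s + s)) * 2
  early = solve-∀
  at-a₂ : ∀ s → suc ((1 + s) * 2 + (4 + (s + s))) + (2 + (s + s)) ≡ (3 + (s + s)) + (3 + (s + s)) * 2
  at-a₂ = solve-∀
  room : ∀ t → 3 * (3 + t) ≡ (3 + t) + (3 + t) * 2
  room = solve-∀

  too-late : ∀ {e} → 3 + t ≤ e → suc e + L ≤ 3 * (3 + t) → ⊥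
  too-late {e} 3+t≤e = <⇒≱ (subst (_< suc e + L) (sym (room t)) (+-monoˡ-< L (s≤s 3+t≤e)))

  by-location : ∀ {e} → e ≤ 1 + t ⊎ e ≡ 2 + t ⊎ e ≡ 3 + t ⊎ 4 + t ≤ e →
                PowerAt (3 + t) (W t) (suc e) (c₁ ∷ c₂ ∷ []) → suc e + L ≤ 3 * (3 + t) → ⊥
  by-location {e} (inj₁ e≤1+t) power _ =
    a≢b (agree (c₁ ∷ c₂ ∷ []) (2 + t) (2 + s) power (s≤s e≤1+t) (<-by e (early s e))
          (a₁ t) (b₂-at t (b₂-from-a₁ s)))
  by-location (inj₂ (inj₁ refl)) power _ =
    a≢b (agree (c₁ ∷ c₂ ∷ []) (4 + t) (1 + s) power (n≤1+n (3 + t)) (<-by (2 + t) (at-a₂ s))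
          (a₂ t) (b₂-at t (b₂-from-a₂ s)))
  by-location (inj₂ (inj₂ (inj₁ refl))) _ fits = too-late ≤-refl fits
  by-location (inj₂ (inj₂ (inj₂ 4+t≤e))) _ fits = too-late (≤-trans (n≤1+n (3 + t)) 4+t≤e) fits

SmallMultiple : ℕ → ℕ → Set
SmallMultiple r j = j ≡ r ⊎ j ≡ 2 * r ⊎ j ≡ 3 * r

-- Every r-th power in W t (t = 2s) starts at the first position and has length
-- r, 2r or 3r.  Since |W t| = 3r, |x| ≤ 3, and |x| = 3 leaves no room to shift.
power-shape : (s i : ℕ) (x : FWord) → ¬ x ≡ [] →
              PowerAt (3 + (s + s)) (W (s + s)) i x →
              i + (3 + (s + s)) * length x ≤ 3 * (3 + (s + s)) →
              i ≡ 0 × SmallMultiple (3 + (s + s)) ((3 + (s + s)) * length x)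
power-shape s i [] x≢[] _ _ = ⊥-elim (x≢[] refl)
power-shape s zero (c ∷ []) _ _ _ = refl , inj₁ (*-identityʳ (3 + (s + s)))
power-shape s (suc e) (c ∷ []) _ power fits = ⊥-elim (no-shifted-letter-power (s + s) e c power fits)
power-shape s zero (c₁ ∷ c₂ ∷ []) _ _ _ = refl , inj₂ (inj₁ (*-comm (3 + (s + s)) 2))
power-shape s (suc e) (c₁ ∷ c₂ ∷ []) _ power fits = ⊥-elim (no-shifted-square-power s e c₁ c₂ power fits)
power-shape s i (c₁ ∷ c₂ ∷ c₃ ∷ []) _ _ fits =
  n≤0⇒n≡0 (+-cancelʳ-≤ (r * 3) i 0 (subst (i + r * 3 ≤_) (*-comm 3 r) fits)) ,
  inj₂ (inj₂ (*-comm r 3))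
  where
  r = 3 + (s + s)
power-shape s i (c₁ ∷ c₂ ∷ c₃ ∷ c₄ ∷ x) _ _ fits =
  ⊥-elim (<⇒≱ (<-by (i + (2 + (s + s)) + (3 + (s + s)) * length x) (overshoot s i (length x))) fits)
  where
  overshoot : ∀ s i k → suc (3 * (3 + (s + s))) + (i + (2 + (s + s)) + (3 + (s + s)) * k)
                        ≡ i + (3 + (s + s)) * (4 + k)
  overshoot = solve-∀

powers-are-prefixes : (s i j : ℕ) → 1 ≤ i → i ≤ j → j ≤ length (W (s + s)) →
                      IsPower (3 + (s + s)) (factor (W (s + s)) i j) →
                      i ≡ 1 × SmallMultiple (3 + (s + s)) j
powers-are-prefixes s (suc i) j _ i<j j≤|W| (x , x≢[] , contained)
  with power-end (W (s + s)) (3 + (s + s)) i j x i<j j≤|W| contained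
... | refl with power-shape s i x x≢[] (power-at contained)
                  (subst (i + (3 + (s + s)) * length x ≤_) (length-W (s + s)) j≤|W|)
...   | refl , lengths = refl , lengths

first-prefix : (t : ℕ) → IsPower (3 + t) (factor (W t) 1 (3 + t))
first-prefix t = subst (λ j → IsPower (3 + t) (factor (W t) 1 j)) (*-identityʳ (3 + t))
  (prefix-power (3 + t) (a ∷ []) (holes (2 + t) ++ ⟨ a ⟩ ∷ []) _ (sym (++-assoc (holes (2 + t)) (⟨ a ⟩ ∷ []) _)) (λ ())
    (power-exponent (a ∷ []) (+-comm (2 + t) 1)
      (pad (a ∷ []) (2 + t) 1 (2 + t) (sym (*-identityʳ (2 + t))) (lett⊏ ∷ []))))

second-prefix : (s : ℕ) → IsPower (3 + (s + s)) (factor (W (s + s)) 1 (2 * (3 + (s + s))))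
second-prefix s = subst (λ j → IsPower (3 + t) (factor (W t) 1 j)) (*-comm (3 + t) 2)
  (prefix-power (3 + t) ab (holes (2 + t) ++ (⟨ a ⟩ ∷ ⟨ b ⟩ ∷ ⟨ a ⟩ ∷ holes (1 + t))) (tailW t)
    (sym (++-assoc (holes (2 + t)) _ (tailW t))) (λ ())
    (power-exponent ab (exponent s)
      (pad ab (1 + s) (2 + s) (2 + t) (lead s)
        (lett⊏ ∷ lett⊏ ∷ lett⊏ ∷ hole⊏ ∷ holes⊂ t (full (ab ^ʷ s)) (trans (length-full-^ʷ ab s) (double s))))))
  where
  t = s + s
  ab = a ∷ b ∷ []
  lead : ∀ s → 2 + (s + s) ≡ (1 + s) * 2
  lead = solve-∀
  double : ∀ s → s * 2 ≡ s + s
  double = solve-∀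
  exponent : ∀ s → (1 + s) + (2 + s) ≡ 3 + (s + s)
  exponent = solve-∀

-- w ⊂ (baa)^r for r = 3 + 6q: the letters at 2+t, 3+t, 4+t, 6+2t, 7+2t, 8+2t
-- sit at residues 2, 0, 1, 0, 1, 2 modulo 3.
whole-word : (q : ℕ) → IsPower (3 + (q * 3 + q * 3)) (factor (W (q * 3 + q * 3)) 1 (3 * (3 + (q * 3 + q * 3))))
whole-word q = subst (λ j → IsPower (3 + t) (factor (W t) 1 j)) (*-comm (3 + t) 3)
  (prefix-power (3 + t) baa (holes t ++ middle) [] W≡ (λ ())
    (power-exponent baa (exponent q) (pad baa h (2 + (h + (1 + h))) t t≡ middle⊂)))
  where
  t = q * 3 + q * 3
  h = q + q
  baa = b ∷ a ∷ a ∷ []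
  middle : PWord
  middle = ◇ ∷ ◇ ∷ ⟨ a ⟩ ∷ ⟨ b ⟩ ∷ ⟨ a ⟩ ∷ ◇ ∷ (holes t ++ tailW t)
  sixfold : ∀ q → q * 3 + q * 3 ≡ (q + q) * 3
  sixfold = solve-∀
  t≡ : t ≡ h * 3
  t≡ = sixfold q
  exponent : ∀ q → (q + q) + (2 + ((q + q) + (1 + (q + q)))) ≡ 3 + (q * 3 + q * 3)
  exponent = solve-∀
  W≡ : W t ≡ (holes t ++ middle) ++ []
  W≡ = trans (holes-suc-++ (1 + t) _) (trans (holes-suc-++ t _) (sym (++-identityʳ _)))
  middle⊂ : middle ⊂ full (baa ^ʷ (2 + (h + (1 + h))))
  middle⊂ = hole⊏ ∷ hole⊏ ∷ lett⊏ ∷ lett⊏ ∷ lett⊏ ∷ hole⊏ ∷ pad baa h (1 + h) t t≡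
              (lett⊏ ∷ lett⊏ ∷ lett⊏ ∷ holes⊂ t (full (baa ^ʷ h)) (trans (length-full-^ʷ baa h) (sym t≡)))

prefixes-are-powers : (q i j : ℕ) →
  i ≡ 1 × SmallMultiple (3 + (q * 3 + q * 3)) j →
  IsPower (3 + (q * 3 + q * 3)) (factor (W (q * 3 + q * 3)) i j)
prefixes-are-powers q _ _ (refl , inj₁ refl) = first-prefix (q * 3 + q * 3)
prefixes-are-powers q _ _ (refl , inj₂ (inj₁ refl)) = second-prefix (q * 3)
prefixes-are-powers q _ _ (refl , inj₂ (inj₂ refl)) = whole-word q

proposition8 : (r : ℕ) → 0 < r → ¬ (2 ∣ r) → 3 ∣ r →
    (i j : ℕ) → 1 ≤ i → i ≤ j → j ≤ length (wordW r) →
    (IsPower r (factor (wordW r) i j) ⇔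
      (i ≡ 1 × (j ≡ r ⊎ j ≡ 2 * r ⊎ j ≡ 3 * r)))
proposition8 r _ odd 3∣r i j 1≤i i≤j j≤|w| with odd-multiple-of-three odd 3∣r
... | q , refl = mk⇔ (powers-are-prefixes (q * 3) i j 1≤i i≤j j≤|w|) (prefixes-are-powers q i j)
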